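{- Let $J$ be the set of items in a bin that is $\mu$-slacked for some $\mu\ge\varepsilon/8$. Obtain $J'$ from $J$ by the following transformation: for every dense item $i\in J$ and every $j\in[d]$ with $v_j(i)>\varepsilon_1$, round $v_j(i)$ up to a multiple of $\varepsilon_1\varepsilon/8$ (all other weights and all sizes and positions are unchanged). Then the resulting packing of $J'$ is $(\mu-\varepsilon/8)$-slacked.
   Context: Items are $(2,d)$ items: rectangles of width $w(i)$, height $h(i)$ in $[0,1]$ with nonnegative weights $v_1(i),\dots,v_d(i)\le1$, feasibly packed (axis-parallel, disjoint interiors, total weight at most $1$ per dimension) into the bin $[0,1]^2$. Standing parameters: $\varepsilon^{ -1}\in2\mathbb Z$, $\varepsilon\le1/8$, $\varepsilon_1^{ -1}\in\mathbb Z$, $\varepsilon_1\le\min(1/(4d+1),2\varepsilon/3)$. An item is dense if $w(i)h(i)=0$ or $\max_jv_j(i)/(w(i)h(i))>1/\varepsilon_1^2$. A bin with item set $J$ is $\nu$-slacked if $\sum_{i\in J}v_j(i)\le1-\nu$ for all $j\in[d]$, or $|J|=1$, or ($|J|=2$, both items dense, and $\max_jv_j(i)\le1/2$ for both).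
   Formalization: The widths, heights, weights and positions of the items, and the slack μ, are rational. -}

module Defs where

open import Data.Nat as ℕ using (ℕ)
open import Data.Integer as ℤ using (ℤ; +_)
open import Data.Rational
open import Data.Fin using (Fin)
open import Data.List using (List; []; _∷_; length; map; lookup)
open import Data.Product using (_×_; ∃; ∃-syntax)
open import Data.Sum using (_⊎_)
open import Relation.Binary.PropositionalEquality using (_≡_; _≢_)
open import Relation.Nullary using (¬_)
open import Data.List.Relation.Binary.Pointwise using (Pointwise)
open import Data.Nat.Properties using (m*n≢0)

record Item (d : ℕ) : Set where
  constructor item
  field
    w : ℚ
    h : ℚ
    v : Fin d → ℚ
open Item public

-- an item placed in the bin at lower-left corner (x , y)
record Placed (d : ℕ) : Set where
  constructor placed
  field
    itm : Item d
    x   : ℚ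
    y   : ℚ
open Placed public

ValidItem : ∀ {d} → Item d → Set
ValidItem i = (0ℚ ≤ w i × w i ≤ 1ℚ) × (0ℚ ≤ h i × h i ≤ 1ℚ)
            × (∀ j → 0ℚ ≤ v i j × v i j ≤ 1ℚ)

Inside : ∀ {d} → Placed d → Set
Inside p = (0ℚ ≤ x p × x p + w (itm p) ≤ 1ℚ) × (0ℚ ≤ y p × y p + h (itm p) ≤ 1ℚ)

-- open interiors (x1,x1+w1)×(y1,y1+h1) and (x2,x2+w2)×(y2,y2+h2) are disjoint
InteriorsDisjoint : ∀ {d} → Placed d → Placed d → Set
InteriorsDisjoint p q =
  w (itm p) ≡ 0ℚ ⊎ h (itm p) ≡ 0ℚ ⊎ w (itm q) ≡ 0ℚ ⊎ h (itm q) ≡ 0ℚ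
  ⊎ x p + w (itm p) ≤ x q ⊎ x q + w (itm q) ≤ x p
  ⊎ y p + h (itm p) ≤ y q ⊎ y q + h (itm q) ≤ y p

sumℚ : List ℚ → ℚ
sumℚ []       = 0ℚ
sumℚ (a ∷ as) = a + sumℚ as

weight : ∀ {d} → List (Placed d) → Fin d → ℚ
weight J j = sumℚ (map (λ p → v (itm p) j) J)

FeasiblePacking : ∀ {d} → List (Placed d) → Set
FeasiblePacking J =
    (∀ a → ValidItem (itm (lookup J a)))
  × (∀ a → Inside (lookup J a))
  × (∀ a b → a ≢ b → InteriorsDisjoint (lookup J a) (lookup J b))
  × (∀ j → weight J j ≤ 1ℚ)

-- dense w.r.t. ε₁ = 1 / n₁ :  w h = 0  or  max_j v_j / (w h) > 1/ε₁² ,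
-- the latter written (for w h > 0) as  ∃ j, v_j > n₁² · (w h)
Dense : ∀ {d} → (n₁ : ℕ) → Item d → Set
Dense n₁ i = w i * h i ≡ 0ℚ
           ⊎ ∃[ j ] ((+ (n₁ ℕ.* n₁) / 1) * (w i * h i) < v i j)

Slacked : ∀ {d} → (n₁ : ℕ) → ℚ → List (Placed d) → Set
Slacked n₁ ν J =
    (∀ j → weight J j ≤ 1ℚ - ν)
  ⊎ length J ≡ 1
  ⊎ ( length J ≡ 2
    × (∀ a → Dense n₁ (itm (lookup J a))
             × (∀ j → v (itm (lookup J a)) j ≤ ½)))

-- ε = 1/e and ε₁ = 1/n₁ (as rationals)
epsQ : (e : ℕ) .{{_ : ℕ.NonZero e}} → ℚ
epsQ e = + 1 / e

-- round q up to a multiple of ε₁ ε / 8 = 1/(8 e n₁), i.e.  ⌈ q · 8 e n₁ ⌉ / (8 e n₁)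
roundUp : (e n₁ : ℕ) .{{_ : ℕ.NonZero e}} .{{_ : ℕ.NonZero n₁}} → ℚ → ℚ
roundUp e n₁ q =
  _/_ ⌈ q * (+ (8 ℕ.* (e ℕ.* n₁)) / 1) ⌉ (8 ℕ.* (e ℕ.* n₁))
      {{m*n≢0 8 (e ℕ.* n₁) {{_}} {{m*n≢0 e n₁}}}}

RoundedPlaced : ∀ {d} (e n₁ : ℕ) .{{_ : ℕ.NonZero e}} .{{_ : ℕ.NonZero n₁}}
              → Placed d → Placed d → Set
RoundedPlaced e n₁ p p' =
    w (itm p') ≡ w (itm p) × h (itm p') ≡ h (itm p)
  × x p' ≡ x p × y p' ≡ y p
  × (∀ j → (Dense n₁ (itm p) × (+ 1 / n₁) < v (itm p) j
              × v (itm p') j ≡ roundUp e n₁ (v (itm p) j))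
         ⊎ (¬ (Dense n₁ (itm p) × (+ 1 / n₁) < v (itm p) j)
              × v (itm p') j ≡ v (itm p) j))

Rounded : ∀ {d} (e n₁ : ℕ) .{{_ : ℕ.NonZero e}} .{{_ : ℕ.NonZero n₁}}
        → List (Placed d) → List (Placed d) → Set
Rounded e n₁ J J' = Pointwise (RoundedPlaced e n₁) J J'

epsOver8 : (e : ℕ) .{{_ : ℕ.NonZero e}} → ℚ
epsOver8 e = _/_ (+ 1) (8 ℕ.* e) {{m*n≢0 8 e}}

-- Only weights v_j > ε₁ are rounded, and rounding up to the grid (ε₁ε/8)ℤ adds less than one
-- grid step ε₁·ε/8 < v_j·ε/8. So every weight, hence every bin weight W ≤ 1, grows at most by
-- the factor 1 + ε/8, and W ≤ 1 − μ turns into W(1 + ε/8) ≤ 1 − (μ − ε/8). The other two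
-- forms of slackness survive: the number of items is unchanged, density depends only on the
-- unchanged sizes and is monotone in the weights, and since ½ lies on the grid (its
-- denominator 8en₁ is even) rounding up never crosses it.
module Submission where

open import Defs
open import Data.Nat as ℕ using (ℕ; _≤_; _*_; _+_; NonZero)
open import Data.Integer using (+_)
open import Data.Rational using (ℚ; _/_; _-_) renaming (_≤_ to _≤ℚ_; _*_ to _*ℚ_)
open import Data.Product using (∃-syntax)
open import Data.List using (List)
open import Relation.Binary.PropositionalEquality using (_≡_)

open import Data.Fin using (zero; suc)
import Data.Integer.Base as ℤ
import Data.Integer.DivMod as ℤ
import Data.Integer.Properties as ℤ
open import Data.Integer.Tactic.RingSolver using (solve-∀)
open import Data.List using (_∷_; lookup)
open import Data.List.Relation.Binary.Pointwise using (Pointwise; []; _∷_; Pointwise-length)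
import Data.Nat.Properties as ℕ
open import Data.Product using (_×_; _,_; proj₁; proj₂)
open import Data.Rational.Base as ℚ using (↥_; ↧_; ↧ₙ_; -_; floor; ceiling; toℚᵘ; 0ℚ; 1ℚ; ½)
  renaming (_+_ to _+ℚ_; _<_ to _<ℚ_)
import Data.Rational.Properties as ℚ
open import Data.Rational.Solver using (module +-*-Solver)
open import Data.Rational.Unnormalised.Base as ℚᵘ using (mkℚᵘ; *≡*; *≤*; *<*)
  renaming (_≃_ to _≃ᵘ_; _/_ to _/ᵘ_)
import Data.Rational.Unnormalised.Properties as ℚᵘ
open import Data.Sum using (inj₁; inj₂)
open import Relation.Binary.PropositionalEquality using (refl; sym; trans; cong; cong₂; subst; module ≡-Reasoning)

⌊q⌋*↧q≤↥q : ∀ q → ⌊ q ⌋ ℤ.* ↧ q ℤ.≤ ↥ q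
⌊q⌋*↧q≤↥q q@record{} = ℤ.[n/d]*d≤n (↥ q) (↧ q)

↥q<suc⌊q⌋*↧q : ∀ q → ↥ q ℤ.< ℤ.suc ⌊ q ⌋ ℤ.* ↧ q
↥q<suc⌊q⌋*↧q q@record{} =
  subst (λ k → ↥ q ℤ.< ℤ.suc k ℤ.* ↧ q) (sym (ℤ.div-pos-is-/ℕ (↥ q) (↧ₙ q)))
        (ℤ.n<s[n/ℕd]*d (↥ q) (↧ₙ q))

↥q≤⌈q⌉*↧q : ∀ q → ↥ q ℤ.≤ ⌈ q ⌉ ℤ.* ↧ q
↥q≤⌈q⌉*↧q q@record{} = begin
  ↥ q                          ≡⟨ ℤ.neg-involutive (↥ q) ⟨
  ℤ.- (ℤ.- ↥ q)                ≡⟨ cong ℤ.-_ (ℚ.↥-neg q) ⟨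
  ℤ.- ↥ (- q)                  ≤⟨ ℤ.neg-mono-≤ (⌊q⌋*↧q≤↥q (- q)) ⟩
  ℤ.- (⌊ - q ⌋ ℤ.* ↧ (- q))    ≡⟨ cong (λ d → ℤ.- (⌊ - q ⌋ ℤ.* d)) (ℚ.↧-neg q) ⟩
  ℤ.- (⌊ - q ⌋ ℤ.* ↧ q)        ≡⟨ ℤ.neg-distribˡ-* ⌊ - q ⌋ (↧ q) ⟩
  ℤ.- ⌊ - q ⌋ ℤ.* ↧ q          ∎
  where open ℤ.≤-Reasoning

⌈q⌉*↧q<↥q+↧q : ∀ q → ⌈ q ⌉ ℤ.* ↧ q ℤ.< ↥ q ℤ.+ ↧ q
⌈q⌉*↧q<↥q+↧q q@record{} = begin-strict
  ℤ.- ⌊ - q ⌋ ℤ.* ↧ q                         ≡⟨ shift ⌊ - q ⌋ (↧ q) ⟩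
  ℤ.- (ℤ.suc ⌊ - q ⌋ ℤ.* ↧ q) ℤ.+ ↧ q          ≡⟨ cong (λ d → ℤ.- (ℤ.suc ⌊ - q ⌋ ℤ.* d) ℤ.+ ↧ q) (ℚ.↧-neg q) ⟨
  ℤ.- (ℤ.suc ⌊ - q ⌋ ℤ.* ↧ (- q)) ℤ.+ ↧ q      <⟨ ℤ.+-monoˡ-< (↧ q) (ℤ.neg-mono-< (↥q<suc⌊q⌋*↧q (- q))) ⟩
  ℤ.- ↥ (- q) ℤ.+ ↧ q                          ≡⟨ cong (λ n → ℤ.- n ℤ.+ ↧ q) (ℚ.↥-neg q) ⟩
  ℤ.- (ℤ.- ↥ q) ℤ.+ ↧ q                        ≡⟨ cong (ℤ._+ ↧ q) (ℤ.neg-involutive (↥ q)) ⟩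
  ↥ q ℤ.+ ↧ q                                  ∎
  where
  open ℤ.≤-Reasoning
  shift : ∀ f d → ℤ.- f ℤ.* d ≡ ℤ.- ((+ 1 ℤ.+ f) ℤ.* d) ℤ.+ d
  shift = solve-∀

toℚᵘ-/ : ∀ i n .{{_ : NonZero n}} → toℚᵘ (i / n) ≃ᵘ i /ᵘ n
toℚᵘ-/ i (ℕ.suc n) = ℚ.toℚᵘ-fromℚᵘ (mkℚᵘ i n)

q≤i/1⇒↥q≤i*↧q : ∀ {q i} → q ≤ℚ i / 1 → ↥ q ℤ.≤ i ℤ.* ↧ q
q≤i/1⇒↥q≤i*↧q {q@record{}} {i} q≤i with ℚᵘ.≤-respʳ-≃ (toℚᵘ-/ i 1) (ℚ.toℚᵘ-mono-≤ q≤i)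
... | *≤* ↥q*1≤i*↧q = subst (ℤ._≤ i ℤ.* ↧ q) (ℤ.*-identityʳ (↥ q)) ↥q*1≤i*↧q

↥q≤i*↧q⇒q≤i/1 : ∀ {q i} → ↥ q ℤ.≤ i ℤ.* ↧ q → q ≤ℚ i / 1
↥q≤i*↧q⇒q≤i/1 {q@record{}} {i} ↥q≤i*↧q = ℚ.toℚᵘ-cancel-≤ (ℚᵘ.≤-respʳ-≃ (ℚᵘ.≃-sym (toℚᵘ-/ i 1))
  (*≤* (subst (ℤ._≤ i ℤ.* ↧ q) (sym (ℤ.*-identityʳ (↥ q))) ↥q≤i*↧q)))

q≤⌈q⌉/1 : ∀ q → q ≤ℚ ⌈ q ⌉ / 1
q≤⌈q⌉/1 q = ↥q≤i*↧q⇒q≤i/1 {q} {⌈ q ⌉} (↥q≤⌈q⌉*↧q q)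

⌈q⌉/1<q+1 : ∀ q → ⌈ q ⌉ / 1 <ℚ q +ℚ 1ℚ
⌈q⌉/1<q+1 q@record{} = ℚ.toℚᵘ-cancel-<
  (ℚᵘ.<-respˡ-≃ (ℚᵘ.≃-sym (toℚᵘ-/ ⌈ q ⌉ 1)) (ℚᵘ.<-respʳ-≃ (ℚᵘ.≃-sym (ℚ.toℚᵘ-homo-+ q 1ℚ)) (*<* (begin-strict
    ⌈ q ⌉ ℤ.* + (↧ₙ q ℕ.* 1)                  ≡⟨ cong (λ n → ⌈ q ⌉ ℤ.* + n) (ℕ.*-identityʳ (↧ₙ q)) ⟩
    ⌈ q ⌉ ℤ.* ↧ q                             <⟨ ⌈q⌉*↧q<↥q+↧q q ⟩
    ↥ q ℤ.+ ↧ q                               ≡⟨ cong₂ ℤ._+_ (ℤ.*-identityʳ (↥ q)) (ℤ.*-identityˡ (↧ q)) ⟨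
    ↥ q ℤ.* + 1 ℤ.+ + 1 ℤ.* ↧ q               ≡⟨ ℤ.*-identityʳ _ ⟨
    (↥ q ℤ.* + 1 ℤ.+ + 1 ℤ.* ↧ q) ℤ.* + 1     ∎))))
  where open ℤ.≤-Reasoning

q≤i/1⇒⌈q⌉≤i : ∀ {q i} → q ≤ℚ i / 1 → ⌈ q ⌉ ℤ.≤ i
q≤i/1⇒⌈q⌉≤i {q} {i} q≤i = subst (⌈ q ⌉ ℤ.≤_) (ℤ.pred-suc i) (ℤ.i<j⇒i≤pred[j]
  (ℤ.*-cancelʳ-<-nonNeg {⌈ q ⌉} {ℤ.suc i} (↧ q) (begin-strict
    ⌈ q ⌉ ℤ.* ↧ q        <⟨ ⌈q⌉*↧q<↥q+↧q q ⟩
    ↥ q ℤ.+ ↧ q          ≤⟨ ℤ.+-monoˡ-≤ (↧ q) (q≤i/1⇒↥q≤i*↧q {q} {i} q≤i) ⟩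
    i ℤ.* ↧ q ℤ.+ ↧ q    ≡⟨ ℤ.+-comm (i ℤ.* ↧ q) (↧ q) ⟩
    ↧ q ℤ.+ i ℤ.* ↧ q    ≡⟨ ℤ.suc-* i (↧ q) ⟨
    ℤ.suc i ℤ.* ↧ q      ∎)))
  where open ℤ.≤-Reasoning

/-monoˡ-≤ : ∀ {i j} n .{{_ : NonZero n}} → i ℤ.≤ j → i / n ≤ℚ j / n
/-monoˡ-≤ {i} {j} n@(ℕ.suc _) i≤j = ℚ.toℚᵘ-cancel-≤
  (ℚᵘ.≤-respˡ-≃ (ℚᵘ.≃-sym (toℚᵘ-/ i n)) (ℚᵘ.≤-respʳ-≃ (ℚᵘ.≃-sym (toℚᵘ-/ j n))
    (*≤* (ℤ.*-monoʳ-≤-nonNeg (+ n) i≤j))))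

[i/m]*[j/n]≡[i*j]/[m*n] : ∀ i j m n .{{_ : NonZero m}} .{{_ : NonZero n}} →
                          (i / m) *ℚ (j / n) ≡ _/_ (i ℤ.* j) (m * n) {{ℕ.m*n≢0 m n}}
[i/m]*[j/n]≡[i*j]/[m*n] i j m@(ℕ.suc _) n@(ℕ.suc _) = ℚ.toℚᵘ-injective (begin
  toℚᵘ ((i / m) *ℚ (j / n))        ≈⟨ ℚ.toℚᵘ-homo-* (i / m) (j / n) ⟩
  toℚᵘ (i / m) ℚᵘ.* toℚᵘ (j / n)   ≈⟨ ℚᵘ.*-cong (toℚᵘ-/ i m) (toℚᵘ-/ j n) ⟩
  (i /ᵘ m) ℚᵘ.* (j /ᵘ n)           ≈⟨ toℚᵘ-/ (i ℤ.* j) (m * n) ⟨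
  toℚᵘ ((i ℤ.* j) / (m * n))       ∎)
  where open ℚᵘ.≃-Reasoning

[i/n]*n≡i/1 : ∀ i n .{{_ : NonZero n}} → (i / n) *ℚ (+ n / 1) ≡ i / 1
[i/n]*n≡i/1 i n@(ℕ.suc _) = ℚ.toℚᵘ-injective (begin
  toℚᵘ ((i / n) *ℚ (+ n / 1))        ≈⟨ ℚ.toℚᵘ-homo-* (i / n) (+ n / 1) ⟩
  toℚᵘ (i / n) ℚᵘ.* toℚᵘ (+ n / 1)   ≈⟨ ℚᵘ.*-cong (toℚᵘ-/ i n) (toℚᵘ-/ (+ n) 1) ⟩
  (i /ᵘ n) ℚᵘ.* (+ n /ᵘ 1)           ≈⟨ *≡* (trans (ℤ.*-identityʳ (i ℤ.* + n))
                                                   (cong (λ k → i ℤ.* + k) (sym (ℕ.*-identityʳ n)))) ⟩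
  i /ᵘ 1                             ≈⟨ toℚᵘ-/ i 1 ⟨
  toℚᵘ (i / 1)                       ∎)
  where open ℚᵘ.≃-Reasoning

N≡2M⇒½≡M/N : ∀ {M N} .{{_ : NonZero N}} → N ≡ 2 * M → ½ ≡ + M / N
N≡2M⇒½≡M/N {M} {N@(ℕ.suc _)} N≡2M = ℚ.toℚᵘ-injective (ℚᵘ.≃-sym (ℚᵘ.≃-trans (toℚᵘ-/ (+ M) N) (*≡* (begin
  + M ℤ.* + 2     ≡⟨ ℤ.pos-* M 2 ⟨
  + (M * 2)       ≡⟨ cong +_ (trans (ℕ.*-comm M 2) (sym N≡2M)) ⟩
  + N             ≡⟨ ℤ.*-identityˡ (+ N) ⟨
  + 1 ℤ.* + N     ∎))))
  where open ≡-Reasoning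

-- roundUp e n₁ is, definitionally, roundUpTo (8 * (e * n₁)).
roundUpTo : (N : ℕ) .{{_ : NonZero N}} → ℚ → ℚ
roundUpTo N q = ⌈ q *ℚ (+ N / 1) ⌉ / N

module _ (N : ℕ) .{{_ : NonZero N}} where

  private
    instance
      N/1-positive : ℚ.Positive (+ N / 1)
      N/1-positive = ℚ.normalize-pos N 1

    roundUpTo*N : ∀ q → roundUpTo N q *ℚ (+ N / 1) ≡ ⌈ q *ℚ (+ N / 1) ⌉ / 1
    roundUpTo*N q = [i/n]*n≡i/1 ⌈ q *ℚ (+ N / 1) ⌉ N

  ≤-roundUpTo : ∀ q → q ≤ℚ roundUpTo N q
  ≤-roundUpTo q = ℚ.*-cancelʳ-≤-pos (+ N / 1) (begin
    q *ℚ (+ N / 1)                ≤⟨ q≤⌈q⌉/1 (q *ℚ (+ N / 1)) ⟩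
    ⌈ q *ℚ (+ N / 1) ⌉ / 1        ≡⟨ roundUpTo*N q ⟨
    roundUpTo N q *ℚ (+ N / 1)    ∎)
    where open ℚ.≤-Reasoning

  roundUpTo-< : ∀ q → roundUpTo N q <ℚ q +ℚ + 1 / N
  roundUpTo-< q = ℚ.*-cancelʳ-<-nonNeg (+ N / 1) {{ℚ.pos⇒nonNeg (+ N / 1)}} (begin-strict
    roundUpTo N q *ℚ (+ N / 1)                       ≡⟨ roundUpTo*N q ⟩
    ⌈ q *ℚ (+ N / 1) ⌉ / 1                           <⟨ ⌈q⌉/1<q+1 (q *ℚ (+ N / 1)) ⟩
    q *ℚ (+ N / 1) +ℚ 1ℚ                             ≡⟨ cong (q *ℚ (+ N / 1) +ℚ_) ([i/n]*n≡i/1 (+ 1) N) ⟨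
    q *ℚ (+ N / 1) +ℚ (+ 1 / N) *ℚ (+ N / 1)         ≡⟨ ℚ.*-distribʳ-+ (+ N / 1) q (+ 1 / N) ⟨
    (q +ℚ + 1 / N) *ℚ (+ N / 1)                      ∎)
    where open ℚ.≤-Reasoning

  roundUpTo-least : ∀ {q i} → q ≤ℚ i / N → roundUpTo N q ≤ℚ i / N
  roundUpTo-least {q} {i} q≤i/N = ℚ.*-cancelʳ-≤-pos (+ N / 1) (begin
    roundUpTo N q *ℚ (+ N / 1)    ≡⟨ roundUpTo*N q ⟩
    ⌈ q *ℚ (+ N / 1) ⌉ / 1        ≤⟨ /-monoˡ-≤ 1 (q≤i/1⇒⌈q⌉≤i {q *ℚ (+ N / 1)} {i} (begin
      q *ℚ (+ N / 1)                ≤⟨ ℚ.*-monoʳ-≤-nonNeg (+ N / 1) {{ℚ.pos⇒nonNeg (+ N / 1)}} q≤i/N ⟩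
      (i / N) *ℚ (+ N / 1)          ≡⟨ [i/n]*n≡i/1 i N ⟩
      i / 1                         ∎)) ⟩
    i / 1                         ≡⟨ [i/n]*n≡i/1 i N ⟨
    (i / N) *ℚ (+ N / 1)          ∎)
    where open ℚ.≤-Reasoning

  roundUpTo-≤½ : ∀ {M q} → N ≡ 2 * M → q ≤ℚ ½ → roundUpTo N q ≤ℚ ½
  roundUpTo-≤½ {M} {q} N≡2M q≤½ = subst (roundUpTo N q ≤ℚ_) (sym ½≡M/N)
    (roundUpTo-least {q} {+ M} (subst (q ≤ℚ_) ½≡M/N q≤½))
    where ½≡M/N = N≡2M⇒½≡M/N {M} {N} N≡2M

Pointwise-lookup-map : ∀ {a b r p q} {A : Set a} {B : Set b} {R : A → B → Set r}
                         {P : A → Set p} {Q : B → Set q}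
                     → (∀ {a b} → R a b → P a → Q b)
                     → ∀ {as bs} → Pointwise R as bs
                     → (∀ i → P (lookup as i)) → ∀ i → Q (lookup bs i)
Pointwise-lookup-map R⇒ (Rab ∷ _)    Pa zero    = R⇒ Rab (Pa zero)
Pointwise-lookup-map R⇒ (_   ∷ Rabs) Pa (suc i) = Pointwise-lookup-map R⇒ Rabs (λ k → Pa (suc k)) i

slack-loss : ∀ {W μ a} → W ≤ℚ 1ℚ - μ → W ≤ℚ 1ℚ → 0ℚ ≤ℚ a → W *ℚ (1ℚ +ℚ a) ≤ℚ 1ℚ - (μ - a)
slack-loss {W} {μ} {a} W≤1-μ W≤1 0≤a = begin
  W *ℚ (1ℚ +ℚ a)      ≡⟨ ℚ.*-distribˡ-+ W 1ℚ a ⟩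
  W *ℚ 1ℚ +ℚ W *ℚ a   ≤⟨ ℚ.+-mono-≤ (ℚ.≤-trans (ℚ.≤-reflexive (ℚ.*-identityʳ W)) W≤1-μ)
                                   (ℚ.*-monoʳ-≤-nonNeg a {{ℚ.nonNegative 0≤a}} W≤1) ⟩
  (1ℚ - μ) +ℚ 1ℚ *ℚ a ≡⟨ cong ((1ℚ - μ) +ℚ_) (ℚ.*-identityˡ a) ⟩
  (1ℚ - μ) +ℚ a       ≡⟨ solve 3 (λ o m a → (o :- m) :+ a := o :- (m :- a)) refl 1ℚ μ a ⟩
  1ℚ - (μ - a)        ∎
  where
  open ℚ.≤-Reasoning
  open +-*-Solver

Dense-mono : ∀ {d} n₁ {i i' : Item d} → w i' ≡ w i → h i' ≡ h i
           → (∀ j → v i j ≤ℚ v i' j) → Dense n₁ i → Dense n₁ i'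
Dense-mono n₁ {i} {i'} w≡ h≡ v≤v' = λ where
    (inj₁ area≡0)      → inj₁ (trans area≡ area≡0)
    (inj₂ (j , heavy)) → inj₂ (j , ℚ.<-≤-trans
      (subst (λ A → (+ (n₁ * n₁) / 1) *ℚ A <ℚ v i j) (sym area≡) heavy) (v≤v' j))
  where
  area≡ : w i' *ℚ h i' ≡ w i *ℚ h i
  area≡ = cong₂ _*ℚ_ w≡ h≡

DenseAndSmall : ∀ {d} → ℕ → Placed d → Set
DenseAndSmall n₁ p = Dense n₁ (itm p) × (∀ j → v (itm p) j ≤ℚ ½)

0≤epsOver8 : ∀ e .{{_ : NonZero e}} → 0ℚ ≤ℚ epsOver8 e
0≤epsOver8 e = ℚ.nonNegative⁻¹ (epsOver8 e) {{ℚ.normalize-nonNeg 1 (8 * e) {{ℕ.m*n≢0 8 e}}}}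

module _ {d : ℕ} (e n₁ : ℕ) .{{_ : NonZero e}} .{{_ : NonZero n₁}} where

  private
    instance
      8e-nonZero : NonZero (8 * e)
      8e-nonZero = ℕ.m*n≢0 8 e
      8en₁-nonZero : NonZero (8 * (e * n₁))
      8en₁-nonZero = ℕ.m*n≢0 8 (e * n₁) {{_}} {{ℕ.m*n≢0 e n₁}}
      n₁8e-nonZero : NonZero (n₁ * (8 * e))
      n₁8e-nonZero = ℕ.m*n≢0 n₁ (8 * e)
      epsOver8-nonNeg : ℚ.NonNegative (epsOver8 e)
      epsOver8-nonNeg = ℚ.nonNegative (0≤epsOver8 e)

  grid-step : + 1 / (8 * (e * n₁)) ≡ (+ 1 / n₁) *ℚ epsOver8 e
  grid-step = begin
    + 1 / (8 * (e * n₁))         ≡⟨ ℚ./-cong {p₁ = + 1} {p₂ = + 1} refl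
                                      (trans (sym (ℕ.*-assoc 8 e n₁)) (ℕ.*-comm (8 * e) n₁)) ⟩
    + 1 / (n₁ * (8 * e))         ≡⟨ [i/m]*[j/n]≡[i*j]/[m*n] (+ 1) (+ 1) n₁ (8 * e) ⟨
    (+ 1 / n₁) *ℚ epsOver8 e     ∎
    where open ≡-Reasoning

  v-≤-rounded : ∀ {p p' : Placed d} → RoundedPlaced e n₁ p p' → ∀ j → v (itm p) j ≤ℚ v (itm p') j
  v-≤-rounded {p} (_ , _ , _ , _ , weights) j with weights j
  ... | inj₁ (_ , _ , q'≡) = subst (v (itm p) j ≤ℚ_) (sym q'≡) (≤-roundUpTo (8 * (e * n₁)) (v (itm p) j))
  ... | inj₂ (_ , q'≡)     = ℚ.≤-reflexive (sym q'≡)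

  v-rounded-≤ : ∀ {p p' : Placed d} → RoundedPlaced e n₁ p p' → ∀ j → 0ℚ ≤ℚ v (itm p) j
              → v (itm p') j ≤ℚ v (itm p) j *ℚ (1ℚ +ℚ epsOver8 e)
  v-rounded-≤ {p} {p'} (_ , _ , _ , _ , weights) j 0≤q with weights j
  ... | inj₁ (_ , ε₁<q , q'≡) = begin
    v (itm p') j                        ≡⟨ q'≡ ⟩
    roundUp e n₁ q                      ≤⟨ ℚ.<⇒≤ (roundUpTo-< (8 * (e * n₁)) q) ⟩
    q +ℚ + 1 / (8 * (e * n₁))           ≡⟨ cong (q +ℚ_) grid-step ⟩
    q +ℚ (+ 1 / n₁) *ℚ epsOver8 e       ≤⟨ ℚ.+-monoʳ-≤ q (ℚ.*-monoʳ-≤-nonNeg (epsOver8 e) (ℚ.<⇒≤ ε₁<q)) ⟩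
    q +ℚ q *ℚ epsOver8 e                ≡⟨ cong (_+ℚ q *ℚ epsOver8 e) (ℚ.*-identityʳ q) ⟨
    q *ℚ 1ℚ +ℚ q *ℚ epsOver8 e          ≡⟨ ℚ.*-distribˡ-+ q 1ℚ (epsOver8 e) ⟨
    q *ℚ (1ℚ +ℚ epsOver8 e)             ∎
    where
    open ℚ.≤-Reasoning
    q = v (itm p) j
  ... | inj₂ (_ , q'≡) = begin
    v (itm p') j                        ≡⟨ q'≡ ⟩
    q                                   ≡⟨ ℚ.*-identityʳ q ⟨
    q *ℚ 1ℚ                             ≤⟨ ℚ.*-monoˡ-≤-nonNeg q {{ℚ.nonNegative 0≤q}} 1≤1+ε/8 ⟩
    q *ℚ (1ℚ +ℚ epsOver8 e)             ∎
    where
    open ℚ.≤-Reasoning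
    q = v (itm p) j
    1≤1+ε/8 : 1ℚ ≤ℚ 1ℚ +ℚ epsOver8 e
    1≤1+ε/8 = subst (_≤ℚ 1ℚ +ℚ epsOver8 e) (ℚ.+-identityʳ 1ℚ) (ℚ.+-monoʳ-≤ 1ℚ (0≤epsOver8 e))

  v-rounded-≤½ : ∀ {p p' : Placed d} → RoundedPlaced e n₁ p p' → ∀ j
               → v (itm p) j ≤ℚ ½ → v (itm p') j ≤ℚ ½
  v-rounded-≤½ (_ , _ , _ , _ , weights) j q≤½ with weights j
  ... | inj₁ (_ , _ , q'≡) = subst (_≤ℚ ½) (sym q'≡)
          (roundUpTo-≤½ (8 * (e * n₁)) {4 * (e * n₁)} (ℕ.*-assoc 2 4 (e * n₁)) q≤½)
  ... | inj₂ (_ , q'≡)     = subst (_≤ℚ ½) (sym q'≡) q≤½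

  DenseAndSmall-rounded : ∀ {p p' : Placed d} → RoundedPlaced e n₁ p p'
                        → DenseAndSmall n₁ p → DenseAndSmall n₁ p'
  DenseAndSmall-rounded r@(w≡ , h≡ , _) (dense , small) =
    Dense-mono n₁ w≡ h≡ (v-≤-rounded r) dense , λ j → v-rounded-≤½ r j (small j)

  weight-rounded-≤ : ∀ {J J' : List (Placed d)} → Rounded e n₁ J J' → ∀ j
                   → (∀ i → 0ℚ ≤ℚ v (itm (lookup J i)) j)
                   → weight J' j ≤ℚ weight J j *ℚ (1ℚ +ℚ epsOver8 e)
  weight-rounded-≤ [] j _ = ℚ.≤-reflexive (sym (ℚ.*-zeroˡ (1ℚ +ℚ epsOver8 e)))
  weight-rounded-≤ {p ∷ J} {p' ∷ J'} (r ∷ rs) j 0≤v = begin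
    v (itm p') j +ℚ weight J' j                    ≤⟨ ℚ.+-mono-≤ (v-rounded-≤ r j (0≤v zero))
                                                                  (weight-rounded-≤ rs j (λ i → 0≤v (suc i))) ⟩
    v (itm p) j *ℚ c +ℚ weight J j *ℚ c            ≡⟨ ℚ.*-distribʳ-+ c (v (itm p) j) (weight J j) ⟨
    (v (itm p) j +ℚ weight J j) *ℚ c               ∎
    where
    open ℚ.≤-Reasoning
    c = 1ℚ +ℚ epsOver8 e

lemma52 : (d : ℕ) (e n₁ : ℕ) .{{_ : NonZero e}} .{{_ : NonZero n₁}}
    → (∃[ k ] e ≡ 2 * k) → 8 ≤ e
    → 4 * d + 1 ≤ n₁ → 3 * e ≤ 2 * n₁
    → (μ : ℚ) → epsOver8 e ≤ℚ μ
    → (J : List (Placed d)) → FeasiblePacking J → Slacked n₁ μ J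
    → (J' : List (Placed d)) → Rounded e n₁ J J'
    → Slacked n₁ (μ - epsOver8 e) J'
lemma52 d e n₁ _ _ _ _ μ _ J (valid , _ , _ , weight≤1) (inj₁ weight≤1-μ) J' rounded =
  inj₁ λ j → ℚ.≤-trans (weight-rounded-≤ e n₁ rounded j (λ i → proj₁ (proj₂ (proj₂ (valid i)) j)))
                       (slack-loss {μ = μ} (weight≤1-μ j) (weight≤1 j) (0≤epsOver8 e))
lemma52 d e n₁ _ _ _ _ μ _ J _ (inj₂ (inj₁ |J|≡1)) J' rounded =
  inj₂ (inj₁ (trans (sym (Pointwise-length rounded)) |J|≡1))
lemma52 d e n₁ _ _ _ _ μ _ J _ (inj₂ (inj₂ (|J|≡2 , denseAndSmall))) J' rounded =
  inj₂ (inj₂ (trans (sym (Pointwise-length rounded)) |J|≡2 ,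
              Pointwise-lookup-map (DenseAndSmall-rounded e n₁) rounded denseAndSmall))
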